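{- Let $R,S$ be terminating paths with $\mathrm{sp}(R)=\mathrm{ep}(S)$ and $\mathrm{sp}(S)=\mathrm{ep}(R)$. If $R\mathbin{;}\mathsf{L}\cap(R^{\top}\mathbin{;}\mathsf{L}\cup S\mathbin{;}\mathsf{L})\cap S^{\top}\mathbin{;}\mathsf{L}=\mathsf{O}$, then $R\cup S$ is a cycle.
   Context: $(B,\cup,\mathbin{;},\overline{\,\cdot\,},{}^{\top},{}^{*},\mathsf{I})$ is a Kleene relation algebra; all variables range over $B$. That is, $(B,\cup,\mathbin{;},\overline{\,\cdot\,},{}^{\top},\mathsf{I})$ is a relation algebra: $\cup$ is associative and commutative and $R=\overline{\overline{R}\cup\overline{S}}\cup\overline{\overline{R}\cup S}$; $\mathbin{;}$ is associative, $(R\cup S)\mathbin{;}T=R\mathbin{;}T\cup S\mathbin{;}T$, $R\mathbin{;}\mathsf{I}=R$; $(R^{\top})^{\top}=R$, $(R\cup S)^{\top}=R^{\top}\cup S^{\top}$, $(R\mathbin{;}S)^{\top}=S^{\top}\mathbin{;}R^{\top}$; $R^{\top}\mathbin{;}\overline{R\mathbin{;}S}\cup\overline{S}=\overline{S}$. The order is $R\subseteq S$ iff $R\cup S=S$; $R\cap S=\overline{\overline{R}\cup\overline{S}}$; $\mathsf{L}=R\cup\overline{R}$ is the greatest and $\mathsf{O}=R\cap\overline{R}$ the least element. The star satisfies $\mathsf{I}\cup R\mathbin{;}R^*\subseteq R^*$, $\mathsf{I}\cup R^*\mathbin{;}R\subseteq R^*$, $S\cup R\mathbin{;}Q\subseteq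 Q\Rightarrow R^*\mathbin{;}S\subseteq Q$, $S\cup Q\mathbin{;}R\subseteq Q\Rightarrow S\mathbin{;}R^*\subseteq Q$. Write $R^{\top*}=(R^{\top})^*$. The algebra satisfies the Tarski rule ($R\neq\mathsf{O}$ iff $\mathsf{L}\mathbin{;}R\mathbin{;}\mathsf{L}=\mathsf{L}$) and the point axiom (for every $R\neq\mathsf{O}$ there are points $p,q$ with $p\mathbin{;}q^{\top}\subseteq R$), where a point is an element $p$ with $p=p\mathbin{;}\mathsf{L}$, $p\mathbin{;}p^{\top}\subseteq\mathsf{I}$ and $\mathsf{I}\subseteq p^{\top}\mathbin{;}p$. Composition binds tighter than $\cup,\cap$; complement and converse bind tighter than composition. $R$ is univalent if $R^{\top}\mathbin{;}R\subseteq\mathsf{I}$ and injective if $R\mathbin{;}R^{\top}\subseteq\mathsf{I}$. $R$ is connected if $R\mathbin{;}\mathsf{L}\mathbin{;}R\subseteq R^*\cup R^{\top*}$; $R$ is a path if it is injective, univalent and connected. $\mathrm{sp}(R)=R\mathbin{;}\mathsf{L}\cap\overline{R^{\top}\mathbin{;}\mathsf{L}}$ and $\mathrm{ep}(R)=R^{\top}\mathbin{;}\mathsf{L}\cap\overline{R\mathbin{;}\mathsf{L}}$. A path $R$ is terminating if ($\mathrm{sp}(R)\neq\mathsf{O}$ or $R=\mathsf{O}$) and ($\mathrm{ep}(R)\neq\mathsf{O}$ or $R=\mathsf{O}$). A path $R$ is a cycle if $R^*=R^{\top*}$. -}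

module Defs where

open import Level using (Level; suc; _⊔_)
open import Relation.Binary.PropositionalEquality using (_≡_)
open import Relation.Nullary using (¬_)
open import Data.Product using (∃₂; _×_)
open import Data.Sum using (_⊎_)

record KleeneRelationAlgebra (c : Level) : Set (suc c) where
  infixl 6 _∪_
  infixl 7 _⨾_
  field
    Carrier : Set c
    _∪_     : Carrier → Carrier → Carrier
    _⨾_     : Carrier → Carrier → Carrier
    ∁       : Carrier → Carrier
    _ᵀ      : Carrier → Carrier
    _⋆      : Carrier → Carrier
    I       : Carrier

  _⊆_ : Carrier → Carrier → Set c
  R ⊆ S = R ∪ S ≡ S

  _∩_ : Carrier → Carrier → Carrier
  R ∩ S = ∁ (∁ R ∪ ∁ S)

  L : Carrier
  L = I ∪ ∁ I

  O : Carrier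
  O = I ∩ ∁ I

  infixl 5 _∩_

  field
    ∪-assoc   : ∀ R S T → (R ∪ S) ∪ T ≡ R ∪ (S ∪ T)
    ∪-comm    : ∀ R S → R ∪ S ≡ S ∪ R
    huntington : ∀ R S → R ≡ ∁ (∁ R ∪ ∁ S) ∪ ∁ (∁ R ∪ S)
    ⨾-assoc   : ∀ R S T → (R ⨾ S) ⨾ T ≡ R ⨾ (S ⨾ T)
    ⨾-distribʳ : ∀ R S T → (R ∪ S) ⨾ T ≡ R ⨾ T ∪ S ⨾ T
    ⨾-identityʳ : ∀ R → R ⨾ I ≡ R
    ᵀ-invol   : ∀ R → (R ᵀ) ᵀ ≡ R
    ᵀ-∪       : ∀ R S → (R ∪ S) ᵀ ≡ R ᵀ ∪ S ᵀ
    ᵀ-⨾       : ∀ R S → (R ⨾ S) ᵀ ≡ S ᵀ ⨾ R ᵀ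
    schroeder : ∀ R S → R ᵀ ⨾ ∁ (R ⨾ S) ∪ ∁ S ≡ ∁ S
    star-unfoldˡ : ∀ R → (I ∪ R ⨾ (R ⋆)) ⊆ (R ⋆)
    star-unfoldʳ : ∀ R → (I ∪ (R ⋆) ⨾ R) ⊆ (R ⋆)
    star-inductˡ : ∀ R S Q → (S ∪ R ⨾ Q) ⊆ Q → ((R ⋆) ⨾ S) ⊆ Q
    star-inductʳ : ∀ R S Q → (S ∪ Q ⨾ R) ⊆ Q → (S ⨾ (R ⋆)) ⊆ Q

  IsPoint : Carrier → Set c
  IsPoint p = (p ≡ p ⨾ L) × ((p ⨾ (p ᵀ)) ⊆ I) × (I ⊆ ((p ᵀ) ⨾ p))

  field
    tarski-⇒ : ∀ R → ¬ (R ≡ O) → L ⨾ R ⨾ L ≡ L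
    tarski-⇐ : ∀ R → L ⨾ R ⨾ L ≡ L → ¬ (R ≡ O)
    point-axiom : ∀ R → ¬ (R ≡ O) →
      ∃₂ λ p q → IsPoint p × IsPoint q × ((p ⨾ (q ᵀ)) ⊆ R)

  univalent : Carrier → Set c
  univalent R = ((R ᵀ) ⨾ R) ⊆ I

  injective : Carrier → Set c
  injective R = (R ⨾ (R ᵀ)) ⊆ I

  connected : Carrier → Set c
  connected R = (R ⨾ L ⨾ R) ⊆ ((R ⋆) ∪ ((R ᵀ) ⋆))

  IsPath : Carrier → Set c
  IsPath R = injective R × univalent R × connected R

  sp : Carrier → Carrier
  sp R = R ⨾ L ∩ ∁ ((R ᵀ) ⨾ L)

  ep : Carrier → Carrier
  ep R = (R ᵀ) ⨾ L ∩ ∁ (R ⨾ L)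

  IsTerminating : Carrier → Set c
  IsTerminating R = IsPath R × ((¬ (sp R ≡ O)) ⊎ R ≡ O) × ((¬ (ep R ≡ O)) ⊎ R ≡ O)

  IsCycle : Carrier → Set c
  IsCycle R = IsPath R × (R ⋆ ≡ (R ᵀ) ⋆)

-- The hypothesis, together with sp S = ep R, makes the domains of R and S disjoint and also
-- their ranges, so R ⨾ Sᵀ = O = Rᵀ ⨾ S and R ∪ S stays injective and univalent. On a terminating
-- path every point reaches the end point (Tarski's rule turns L into epᵀ ⨾ ep), and the start
-- point reaches every point. Since the end of each path is the start of the other, this yields
-- connectivity of R ∪ S and, walking once around, Rᵀ ⊆ R⋆ ⨾ S⋆ ⨾ R⋆ and Sᵀ ⊆ S⋆ ⨾ R⋆ ⨾ S⋆;
-- hence (R ∪ S)ᵀ ⊆ (R ∪ S)⋆, which forces the two stars to coincide. If one path is empty its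
-- end points are empty, so the other one is empty as well.
module Submission where

open import Defs
open import Level using (Level)
open import Relation.Nullary using (¬_)
open import Data.Product using (_×_; _,_; proj₁)
open import Data.Sum using (_⊎_; inj₁; inj₂)
open import Data.Empty using (⊥-elim)
open import Relation.Binary.Bundles using (Poset)
import Relation.Binary.Reasoning.PartialOrder as ≤-Reasoning
open import Relation.Binary.PropositionalEquality
  using (_≡_; refl; sym; trans; cong; cong₂; subst; subst₂; isEquivalence; module ≡-Reasoning)

module BooleanLaws {c : Level} (K : KleeneRelationAlgebra c) where
  open KleeneRelationAlgebra K
  open ≡-Reasoning

  ᵀ-identity : I ᵀ ≡ I
  ᵀ-identity = begin
    I ᵀ             ≡⟨ ⨾-identityʳ (I ᵀ) ⟨
    I ᵀ ⨾ I         ≡⟨ cong (I ᵀ ⨾_) (ᵀ-invol I) ⟨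
    I ᵀ ⨾ (I ᵀ) ᵀ   ≡⟨ ᵀ-⨾ (I ᵀ) I ⟨
    (I ᵀ ⨾ I) ᵀ     ≡⟨ cong _ᵀ (⨾-identityʳ (I ᵀ)) ⟩
    (I ᵀ) ᵀ         ≡⟨ ᵀ-invol I ⟩
    I               ∎

  ⨾-identityˡ : ∀ R → I ⨾ R ≡ R
  ⨾-identityˡ R = begin
    I ⨾ R           ≡⟨ ᵀ-invol _ ⟨
    ((I ⨾ R) ᵀ) ᵀ   ≡⟨ cong _ᵀ (ᵀ-⨾ I R) ⟩
    (R ᵀ ⨾ I ᵀ) ᵀ   ≡⟨ cong (λ z → (R ᵀ ⨾ z) ᵀ) ᵀ-identity ⟩
    (R ᵀ ⨾ I) ᵀ     ≡⟨ cong _ᵀ (⨾-identityʳ _) ⟩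
    (R ᵀ) ᵀ         ≡⟨ ᵀ-invol R ⟩
    R               ∎

  -- Idempotence is not an axiom: on complements it is Schröder's axiom for R = I,
  -- and Huntington's axiom transfers it to all elements.
  ∪-idem-∁ : ∀ R → ∁ R ∪ ∁ R ≡ ∁ R
  ∪-idem-∁ R = begin
    ∁ R ∪ ∁ R                 ≡⟨ cong (_∪ ∁ R) (⨾-identityˡ (∁ R)) ⟨
    I ⨾ ∁ R ∪ ∁ R             ≡⟨ cong (λ z → z ⨾ ∁ R ∪ ∁ R) ᵀ-identity ⟨
    I ᵀ ⨾ ∁ R ∪ ∁ R           ≡⟨ cong (λ z → I ᵀ ⨾ ∁ z ∪ ∁ R) (⨾-identityˡ R) ⟨
    I ᵀ ⨾ ∁ (I ⨾ R) ∪ ∁ R     ≡⟨ schroeder I R ⟩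
    ∁ R                       ∎

  private
    O[_] : Carrier → Carrier
    O[ x ] = ∁ (x ∪ ∁ x)

    huntington-self : ∀ x → x ≡ ∁ (∁ x) ∪ O[ x ]
    huntington-self x =
      trans (huntington x x) (cong₂ _∪_ (cong ∁ (∪-idem-∁ x)) (cong ∁ (∪-comm (∁ x) x)))

    ∁∁x∪x≡x : ∀ x → ∁ (∁ x) ∪ x ≡ x
    ∁∁x∪x≡x x = begin
      ∁ (∁ x) ∪ x                     ≡⟨ cong (∁ (∁ x) ∪_) (huntington-self x) ⟩
      ∁ (∁ x) ∪ (∁ (∁ x) ∪ O[ x ])    ≡⟨ ∪-assoc _ _ _ ⟨
      (∁ (∁ x) ∪ ∁ (∁ x)) ∪ O[ x ]    ≡⟨ cong (_∪ O[ x ]) (∪-idem-∁ (∁ x)) ⟩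
      ∁ (∁ x) ∪ O[ x ]                ≡⟨ huntington-self x ⟨
      x                               ∎

    ∁x∪O[x] : ∀ x → ∁ x ∪ O[ x ] ≡ ∁ x
    ∁x∪O[x] x = sym (begin
      ∁ x                                           ≡⟨ huntington (∁ x) (x ∪ ∁ x) ⟩
      ∁ (∁ (∁ x) ∪ O[ x ]) ∪ ∁ (∁ (∁ x) ∪ (x ∪ ∁ x)) ≡⟨ cong₂ _∪_ (cong ∁ (huntington-self x)) (cong ∁ ∁∁x∪x∪∁x) ⟨
      ∁ x ∪ O[ x ]                                  ∎)
      where
        ∁∁x∪x∪∁x : x ∪ ∁ x ≡ ∁ (∁ x) ∪ (x ∪ ∁ x)
        ∁∁x∪x∪∁x = sym (trans (sym (∪-assoc _ _ _)) (cong (_∪ ∁ x) (∁∁x∪x≡x x)))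

    x∪O[x] : ∀ x → x ∪ O[ x ] ≡ x
    x∪O[x] x = begin
      x ∪ O[ x ]                      ≡⟨ cong (_∪ O[ x ]) (huntington-self x) ⟩
      (∁ (∁ x) ∪ O[ x ]) ∪ O[ x ]     ≡⟨ ∪-assoc _ _ _ ⟩
      ∁ (∁ x) ∪ (O[ x ] ∪ O[ x ])     ≡⟨ cong (∁ (∁ x) ∪_) (∪-idem-∁ _) ⟩
      ∁ (∁ x) ∪ O[ x ]                ≡⟨ huntington-self x ⟨
      x                               ∎

    O[∁x] : ∀ x → O[ ∁ x ] ≡ O[ x ]
    O[∁x] x = cong ∁ (begin
      ∁ x ∪ ∁ (∁ x)                   ≡⟨ ∪-comm _ _ ⟩
      ∁ (∁ x) ∪ ∁ x                   ≡⟨ cong₂ (λ a b → ∁ a ∪ ∁ b) (trans (∪-comm _ _) (∁x∪O[x] x))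
                                                                  (trans (∪-comm _ _) (x∪O[x] x)) ⟨
      ∁ (O[ x ] ∪ ∁ x) ∪ ∁ (O[ x ] ∪ x) ≡⟨ huntington (x ∪ ∁ x) x ⟨
      x ∪ ∁ x                         ∎)

  ∁-involutive : ∀ x → ∁ (∁ x) ≡ x
  ∁-involutive x = sym (begin
    x                      ≡⟨ huntington-self x ⟩
    ∁ (∁ x) ∪ O[ x ]       ≡⟨ cong (∁ (∁ x) ∪_) (O[∁x] x) ⟨
    ∁ (∁ x) ∪ O[ ∁ x ]     ≡⟨ ∁x∪O[x] (∁ x) ⟩
    ∁ (∁ x)                ∎)

  ∪-idem : ∀ x → x ∪ x ≡ x
  ∪-idem x = begin
    x ∪ x                  ≡⟨ cong₂ _∪_ (∁-involutive x) (∁-involutive x) ⟨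
    ∁ (∁ x) ∪ ∁ (∁ x)      ≡⟨ ∪-idem-∁ _ ⟩
    ∁ (∁ x)                ≡⟨ ∁-involutive x ⟩
    x                      ∎

  ∩-split : ∀ x y → x ≡ (x ∩ y) ∪ (x ∩ ∁ y)
  ∩-split x y = trans (huntington x y) (cong (λ z → (x ∩ y) ∪ ∁ (∁ x ∪ z)) (sym (∁-involutive y)))

  ∩-comm : ∀ x y → x ∩ y ≡ y ∩ x
  ∩-comm x y = cong ∁ (∪-comm _ _)

  ∪-absorbs-∩ : ∀ x y → x ∪ (x ∩ y) ≡ x
  ∪-absorbs-∩ x y = begin
    x ∪ (x ∩ y)                               ≡⟨ cong (_∪ (x ∩ y)) (∩-split x y) ⟩
    ((x ∩ y) ∪ (x ∩ ∁ y)) ∪ (x ∩ y)           ≡⟨ ∪-assoc _ _ _ ⟩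
    (x ∩ y) ∪ ((x ∩ ∁ y) ∪ (x ∩ y))           ≡⟨ cong ((x ∩ y) ∪_) (∪-comm _ _) ⟩
    (x ∩ y) ∪ ((x ∩ y) ∪ (x ∩ ∁ y))           ≡⟨ ∪-assoc _ _ _ ⟨
    ((x ∩ y) ∪ (x ∩ y)) ∪ (x ∩ ∁ y)           ≡⟨ cong (_∪ (x ∩ ∁ y)) (∪-idem _) ⟩
    (x ∩ y) ∪ (x ∩ ∁ y)                       ≡⟨ ∩-split x y ⟨
    x                                         ∎

  -- The order _⊆_ of Defs has default fixity, so it would bind tighter than _∪_.
  infix 4 _≤_
  _≤_ : Carrier → Carrier → Set c
  A ≤ B = A ⊆ B

  ≤-refl : ∀ {A} → A ≤ A
  ≤-refl = ∪-idem _

  ≤-reflexive : ∀ {A B} → A ≡ B → A ≤ B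
  ≤-reflexive refl = ≤-refl

  ≤-trans : ∀ {A B C} → A ≤ B → B ≤ C → A ≤ C
  ≤-trans {A} {B} {C} A≤B B≤C = begin
    A ∪ C          ≡⟨ cong (A ∪_) B≤C ⟨
    A ∪ (B ∪ C)    ≡⟨ ∪-assoc _ _ _ ⟨
    (A ∪ B) ∪ C    ≡⟨ cong (_∪ C) A≤B ⟩
    B ∪ C          ≡⟨ B≤C ⟩
    C              ∎

  ≤-antisym : ∀ {A B} → A ≤ B → B ≤ A → A ≡ B
  ≤-antisym A≤B B≤A = trans (sym B≤A) (trans (∪-comm _ _) A≤B)

  x≤x∪y : ∀ {A B} → A ≤ A ∪ B
  x≤x∪y {A} {B} = trans (sym (∪-assoc _ _ _)) (cong (_∪ B) (∪-idem A))

  y≤x∪y : ∀ {A B} → B ≤ A ∪ B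
  y≤x∪y {A} {B} = subst (B ≤_) (∪-comm B A) x≤x∪y

  ∪-lub : ∀ {A B C} → A ≤ C → B ≤ C → A ∪ B ≤ C
  ∪-lub {A} A≤C B≤C = trans (∪-assoc _ _ _) (trans (cong (A ∪_) B≤C) A≤C)

  ∪-mono : ∀ {A B C D} → A ≤ C → B ≤ D → A ∪ B ≤ C ∪ D
  ∪-mono A≤C B≤D = ∪-lub (≤-trans A≤C x≤x∪y) (≤-trans B≤D y≤x∪y)

  x∩y≤x : ∀ {A B} → A ∩ B ≤ A
  x∩y≤x {A} {B} = trans (∪-comm _ _) (∪-absorbs-∩ A B)

  x∩y≤y : ∀ {A B} → A ∩ B ≤ B
  x∩y≤y {A} {B} = subst (_≤ B) (∩-comm B A) x∩y≤x

  ∁-∪ : ∀ A B → ∁ (A ∪ B) ≡ ∁ A ∩ ∁ B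
  ∁-∪ A B = cong ∁ (sym (cong₂ _∪_ (∁-involutive A) (∁-involutive B)))

  ∁-antitone : ∀ {A B} → A ≤ B → ∁ B ≤ ∁ A
  ∁-antitone {A} {B} A≤B = subst (_≤ ∁ A) (trans (sym (∁-∪ A B)) (cong ∁ A≤B)) x∩y≤x

  ∩-glb : ∀ {A B C} → C ≤ A → C ≤ B → C ≤ A ∩ B
  ∩-glb {A} {B} {C} C≤A C≤B =
    subst (_≤ A ∩ B) (∁-involutive C) (∁-antitone (∪-lub (∁-antitone C≤A) (∁-antitone C≤B)))

  ∩-mono : ∀ {A B C D} → A ≤ C → B ≤ D → A ∩ B ≤ C ∩ D
  ∩-mono A≤C B≤D = ∩-glb (≤-trans x∩y≤x A≤C) (≤-trans x∩y≤y B≤D)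

  x∪∁x≡L : ∀ x → x ∪ ∁ x ≡ L
  x∪∁x≡L x = ≤-antisym (∪-lub (≤x∪∁x I x) (≤x∪∁x I (∁ x))) (∪-lub (≤x∪∁x x I) (≤x∪∁x x (∁ I)))
    where
      ≤x∪∁x : ∀ x y → y ≤ x ∪ ∁ x
      ≤x∪∁x x y = subst (_≤ x ∪ ∁ x) (sym (∩-split y x)) (∪-mono x∩y≤y x∩y≤y)

  x≤L : ∀ {x} → x ≤ L
  x≤L {x} = subst (x ≤_) (x∪∁x≡L x) x≤x∪y

  x∩∁x≡O : ∀ x → x ∩ ∁ x ≡ O
  x∩∁x≡O x = cong ∁ (trans (x∪∁x≡L (∁ x)) (sym (x∪∁x≡L (∁ I))))

  O≤x : ∀ {x} → O ≤ x
  O≤x {x} = trans (∪-comm _ _) (subst (λ z → x ∪ z ≡ x) (x∩∁x≡O x) (∪-absorbs-∩ x (∁ x)))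

  x≤O⇒x≡O : ∀ {x} → x ≤ O → x ≡ O
  x≤O⇒x≡O x≤O = ≤-antisym x≤O O≤x

  ∩∁≤O⇒≤ : ∀ {A B} → A ∩ ∁ B ≤ O → A ≤ B
  ∩∁≤O⇒≤ {A} {B} A∩∁B≤O = subst (_≤ B) (sym (∩-split A B)) (∪-lub x∩y≤y (≤-trans A∩∁B≤O O≤x))

  ≤∁⇒∩≤O : ∀ {A B} → A ≤ ∁ B → A ∩ B ≤ O
  ≤∁⇒∩≤O {A} {B} A≤∁B = ≤-trans (∩-mono A≤∁B ≤-refl) (≤-reflexive (trans (∩-comm _ _) (x∩∁x≡O B)))

  ∩-distribˡ-∪ : ∀ x y z → x ∩ (y ∪ z) ≤ (x ∩ y) ∪ (x ∩ z)
  ∩-distribˡ-∪ x y z = subst (_≤ (x ∩ y) ∪ (x ∩ z)) (sym (∩-split (x ∩ (y ∪ z)) y))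
    (∪-mono (∩-mono x∩y≤x ≤-refl)
            (∩-glb (≤-trans x∩y≤x x∩y≤x) (≤-trans (∩-glb x∩y≤y (≤-trans x∩y≤x x∩y≤y)) ∁y∩[y∪z]≤z)))
    where
      ∁y∩[y∪z]≤z : ∁ y ∩ (y ∪ z) ≤ z
      ∁y∩[y∪z]≤z = ∩∁≤O⇒≤ (≤-trans (∩-glb (≤-trans x∩y≤x x∩y≤y) (≤-trans (∩-mono x∩y≤x ≤-refl) (≤-reflexive (sym (∁-∪ y z)))))
                                    (≤-reflexive (x∩∁x≡O (y ∪ z))))

module RelationLaws {c : Level} (K : KleeneRelationAlgebra c) where
  open KleeneRelationAlgebra K
  open BooleanLaws K

  ≤-poset : Poset c c c
  ≤-poset = record
    { Carrier = Carrier ; _≈_ = _≡_ ; _≤_ = _≤_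
    ; isPartialOrder = record
      { isPreorder = record { isEquivalence = isEquivalence ; reflexive = ≤-reflexive ; trans = ≤-trans }
      ; antisym = ≤-antisym } }

  open ≤-Reasoning ≤-poset

  ⨾-distribˡ : ∀ R S T → R ⨾ (S ∪ T) ≡ R ⨾ S ∪ R ⨾ T
  ⨾-distribˡ R S T = begin-equality
    R ⨾ (S ∪ T)                     ≡⟨ ᵀ-invol _ ⟨
    ((R ⨾ (S ∪ T)) ᵀ) ᵀ             ≡⟨ cong _ᵀ (ᵀ-⨾ R (S ∪ T)) ⟩
    ((S ∪ T) ᵀ ⨾ R ᵀ) ᵀ             ≡⟨ cong (λ z → (z ⨾ R ᵀ) ᵀ) (ᵀ-∪ S T) ⟩
    ((S ᵀ ∪ T ᵀ) ⨾ R ᵀ) ᵀ           ≡⟨ cong _ᵀ (⨾-distribʳ _ _ _) ⟩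
    (S ᵀ ⨾ R ᵀ ∪ T ᵀ ⨾ R ᵀ) ᵀ       ≡⟨ ᵀ-∪ _ _ ⟩
    (S ᵀ ⨾ R ᵀ) ᵀ ∪ (T ᵀ ⨾ R ᵀ) ᵀ   ≡⟨ cong₂ _∪_ (converse-back S) (converse-back T) ⟩
    R ⨾ S ∪ R ⨾ T                   ∎
    where
      converse-back : ∀ X → (X ᵀ ⨾ R ᵀ) ᵀ ≡ R ⨾ X
      converse-back X = trans (cong _ᵀ (sym (ᵀ-⨾ R X))) (ᵀ-invol _)

  ⨾-monoˡ : ∀ {A B} C → A ≤ B → A ⨾ C ≤ B ⨾ C
  ⨾-monoˡ {A} {B} C A≤B = trans (sym (⨾-distribʳ A B C)) (cong (_⨾ C) A≤B)

  ⨾-monoʳ : ∀ {A B} C → A ≤ B → C ⨾ A ≤ C ⨾ B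
  ⨾-monoʳ {A} {B} C A≤B = trans (sym (⨾-distribˡ C A B)) (cong (C ⨾_) A≤B)

  ⨾-mono : ∀ {A B C D} → A ≤ B → C ≤ D → A ⨾ C ≤ B ⨾ D
  ⨾-mono {A} {B} {C} A≤B C≤D = ≤-trans (⨾-monoˡ C A≤B) (⨾-monoʳ B C≤D)

  ᵀ-mono : ∀ {A B} → A ≤ B → A ᵀ ≤ B ᵀ
  ᵀ-mono {A} {B} A≤B = trans (sym (ᵀ-∪ A B)) (cong _ᵀ A≤B)

  ᵀ-mono⁻ : ∀ {A B} → A ᵀ ≤ B ᵀ → A ≤ B
  ᵀ-mono⁻ {A} {B} Aᵀ≤Bᵀ = subst₂ _≤_ (ᵀ-invol A) (ᵀ-invol B) (ᵀ-mono Aᵀ≤Bᵀ)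

  ᵀ-∩ : ∀ A B → (A ∩ B) ᵀ ≡ A ᵀ ∩ B ᵀ
  ᵀ-∩ A B = ≤-antisym (∩-glb (ᵀ-mono x∩y≤x) (ᵀ-mono x∩y≤y)) (ᵀ-mono⁻ (begin
    (A ᵀ ∩ B ᵀ) ᵀ         ≤⟨ ∩-glb (ᵀ-mono x∩y≤x) (ᵀ-mono x∩y≤y) ⟩
    (A ᵀ) ᵀ ∩ (B ᵀ) ᵀ     ≡⟨ cong₂ _∩_ (ᵀ-invol A) (ᵀ-invol B) ⟩
    A ∩ B                 ≡⟨ ᵀ-invol _ ⟨
    ((A ∩ B) ᵀ) ᵀ         ∎))

  ᵀ-⨾ᵀ : ∀ A B → (A ⨾ B ᵀ) ᵀ ≡ B ⨾ A ᵀ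
  ᵀ-⨾ᵀ A B = trans (ᵀ-⨾ _ _) (cong (_⨾ A ᵀ) (ᵀ-invol B))

  ᵀ-ᵀ⨾ : ∀ A B → (A ᵀ ⨾ B) ᵀ ≡ B ᵀ ⨾ A
  ᵀ-ᵀ⨾ A B = trans (ᵀ-⨾ _ _) (cong (B ᵀ ⨾_) (ᵀ-invol A))

  Lᵀ≡L : L ᵀ ≡ L
  Lᵀ≡L = ≤-antisym x≤L (subst (_≤ L ᵀ) (ᵀ-invol L) (ᵀ-mono x≤L))

  Oᵀ≡O : O ᵀ ≡ O
  Oᵀ≡O = x≤O⇒x≡O (subst (O ᵀ ≤_) (ᵀ-invol O) (ᵀ-mono O≤x))

  ᵀ≤O⇒≤O : ∀ {X} → X ᵀ ≤ O → X ≤ O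
  ᵀ≤O⇒≤O {X} Xᵀ≤O = ᵀ-mono⁻ (subst (X ᵀ ≤_) (sym Oᵀ≡O) Xᵀ≤O)

  schröder-≤ : ∀ {A B C} → A ⨾ B ≤ C → A ᵀ ⨾ ∁ C ≤ ∁ B
  schröder-≤ {A} {B} A⨾B≤C = ≤-trans (⨾-monoʳ (A ᵀ) (∁-antitone A⨾B≤C)) (schroeder A B)

  ⨾-zeroʳ : ∀ A → A ⨾ O ≤ O
  ⨾-zeroʳ A = subst₂ _≤_ (cong₂ _⨾_ (ᵀ-invol A) (∁-involutive O)) (∁-involutive O)
    (schröder-≤ (subst (A ᵀ ⨾ ∁ O ≤_) (sym ∁O≡L) x≤L))
    where
      ∁O≡L : ∁ O ≡ L
      ∁O≡L = trans (∁-involutive _) (x∪∁x≡L (∁ I))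

  ⨾-zeroˡ : ∀ A → O ⨾ A ≤ O
  ⨾-zeroˡ A = ᵀ≤O⇒≤O (begin
    (O ⨾ A) ᵀ     ≡⟨ ᵀ-⨾ O A ⟩
    A ᵀ ⨾ O ᵀ     ≡⟨ cong (A ᵀ ⨾_) Oᵀ≡O ⟩
    A ᵀ ⨾ O       ≤⟨ ⨾-zeroʳ _ ⟩
    O             ∎)

  L⨾L≡L : L ⨾ L ≡ L
  L⨾L≡L = ≤-antisym x≤L (subst (_≤ L ⨾ L) (⨾-identityʳ L) (⨾-monoʳ L x≤L))

  x≤x⨾L : ∀ {X} → X ≤ X ⨾ L
  x≤x⨾L {X} = subst (_≤ X ⨾ L) (⨾-identityʳ X) (⨾-monoʳ X x≤L)

  ≤-∪-elimʳ : ∀ {X A B} → X ≤ A ∪ B → X ∩ B ≤ O → X ≤ A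
  ≤-∪-elimʳ {X} {A} {B} X≤A∪B X∩B≤O = begin
    X                       ≤⟨ ∩-glb ≤-refl X≤A∪B ⟩
    X ∩ (A ∪ B)             ≤⟨ ∩-distribˡ-∪ X A B ⟩
    (X ∩ A) ∪ (X ∩ B)       ≤⟨ ∪-lub x∩y≤y (≤-trans X∩B≤O O≤x) ⟩
    A                       ∎

  ≤-∪-elimˡ : ∀ {X A B} → X ≤ A ∪ B → X ∩ A ≤ O → X ≤ B
  ≤-∪-elimˡ {X} {A} {B} X≤A∪B = ≤-∪-elimʳ (subst (X ≤_) (∪-comm A B) X≤A∪B)

  dedekind : ∀ A B C → A ⨾ B ∩ C ≤ A ⨾ (B ∩ A ᵀ ⨾ C)
  dedekind A B C = ≤-∪-elimʳ {B = ∁ C} (≤-trans x∩y≤x (begin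
    A ⨾ B                                           ≡⟨ cong (A ⨾_) (∩-split B (A ᵀ ⨾ C)) ⟩
    A ⨾ ((B ∩ A ᵀ ⨾ C) ∪ (B ∩ ∁ (A ᵀ ⨾ C)))         ≡⟨ ⨾-distribˡ _ _ _ ⟩
    A ⨾ (B ∩ A ᵀ ⨾ C) ∪ A ⨾ (B ∩ ∁ (A ᵀ ⨾ C))       ≤⟨ ∪-mono ≤-refl (⨾-monoʳ A x∩y≤y) ⟩
    A ⨾ (B ∩ A ᵀ ⨾ C) ∪ A ⨾ ∁ (A ᵀ ⨾ C)             ≤⟨ ∪-mono ≤-refl A⨾∁[Aᵀ⨾C]≤∁C ⟩
    A ⨾ (B ∩ A ᵀ ⨾ C) ∪ ∁ C                         ∎))
    (≤-trans (∩-mono x∩y≤y ≤-refl) (≤-reflexive (x∩∁x≡O C)))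
    where
      A⨾∁[Aᵀ⨾C]≤∁C : A ⨾ ∁ (A ᵀ ⨾ C) ≤ ∁ C
      A⨾∁[Aᵀ⨾C]≤∁C = subst (λ z → z ⨾ ∁ (A ᵀ ⨾ C) ≤ ∁ C) (ᵀ-invol A) (schroeder (A ᵀ) C)

  dedekind′ : ∀ A B C → A ⨾ B ∩ C ≤ (A ∩ C ⨾ B ᵀ) ⨾ B
  dedekind′ A B C = ᵀ-mono⁻ (begin
    (A ⨾ B ∩ C) ᵀ                   ≡⟨ ᵀ-∩ _ _ ⟩
    (A ⨾ B) ᵀ ∩ C ᵀ                 ≡⟨ cong (_∩ C ᵀ) (ᵀ-⨾ A B) ⟩
    B ᵀ ⨾ A ᵀ ∩ C ᵀ                 ≤⟨ dedekind (B ᵀ) (A ᵀ) (C ᵀ) ⟩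
    B ᵀ ⨾ (A ᵀ ∩ (B ᵀ) ᵀ ⨾ C ᵀ)     ≡⟨ cong (λ z → B ᵀ ⨾ (A ᵀ ∩ z)) (ᵀ-⨾ C (B ᵀ)) ⟨
    B ᵀ ⨾ (A ᵀ ∩ (C ⨾ B ᵀ) ᵀ)       ≡⟨ cong (B ᵀ ⨾_) (ᵀ-∩ _ _) ⟨
    B ᵀ ⨾ (A ∩ C ⨾ B ᵀ) ᵀ           ≡⟨ ᵀ-⨾ _ _ ⟨
    ((A ∩ C ⨾ B ᵀ) ⨾ B) ᵀ           ∎)

  x≤x⨾xᵀ⨾x : ∀ X → X ≤ X ⨾ X ᵀ ⨾ X
  x≤x⨾xᵀ⨾x X = begin
    X                     ≤⟨ ∩-glb (≤-reflexive (sym (⨾-identityʳ X))) ≤-refl ⟩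
    X ⨾ I ∩ X             ≤⟨ dedekind X I X ⟩
    X ⨾ (I ∩ X ᵀ ⨾ X)     ≤⟨ ⨾-monoʳ X x∩y≤y ⟩
    X ⨾ (X ᵀ ⨾ X)         ≡⟨ ⨾-assoc _ _ _ ⟨
    X ⨾ X ᵀ ⨾ X           ∎

  I≤⋆ : ∀ R → I ≤ R ⋆
  I≤⋆ R = ≤-trans x≤x∪y (star-unfoldˡ R)

  x⨾x⋆≤x⋆ : ∀ R → R ⨾ R ⋆ ≤ R ⋆
  x⨾x⋆≤x⋆ R = ≤-trans y≤x∪y (star-unfoldˡ R)

  x⋆⨾x≤x⋆ : ∀ R → R ⋆ ⨾ R ≤ R ⋆
  x⋆⨾x≤x⋆ R = ≤-trans y≤x∪y (star-unfoldʳ R)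

  x≤x⋆ : ∀ R → R ≤ R ⋆
  x≤x⋆ R = ≤-trans (subst (_≤ R ⨾ R ⋆) (⨾-identityʳ R) (⨾-monoʳ R (I≤⋆ R))) (x⨾x⋆≤x⋆ R)

  x⋆⨾x⋆≤x⋆ : ∀ R → R ⋆ ⨾ R ⋆ ≤ R ⋆
  x⋆⨾x⋆≤x⋆ R = star-inductˡ R (R ⋆) (R ⋆) (∪-lub ≤-refl (x⨾x⋆≤x⋆ R))

  ⋆-unfold-≤ : ∀ R → R ⋆ ≤ I ∪ R ⨾ R ⋆
  ⋆-unfold-≤ R = subst (_≤ I ∪ R ⨾ R ⋆) (⨾-identityʳ _)
    (star-inductˡ R I (I ∪ R ⨾ R ⋆) (∪-lub x≤x∪y (≤-trans R⨾[I∪R⨾R⋆]≤R⨾R⋆ y≤x∪y)))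
    where
      R⨾[I∪R⨾R⋆]≤R⨾R⋆ : R ⨾ (I ∪ R ⨾ R ⋆) ≤ R ⨾ R ⋆
      R⨾[I∪R⨾R⋆]≤R⨾R⋆ = ⨾-monoʳ R (∪-lub (I≤⋆ R) (x⨾x⋆≤x⋆ R))

  ≤⋆⇒⋆≤⋆ : ∀ {X Y} → X ≤ Y ⋆ → X ⋆ ≤ Y ⋆
  ≤⋆⇒⋆≤⋆ {X} {Y} X≤Y⋆ = subst (_≤ Y ⋆) (⨾-identityʳ _)
    (star-inductˡ X I (Y ⋆) (∪-lub (I≤⋆ Y) (≤-trans (⨾-monoˡ (Y ⋆) X≤Y⋆) (x⋆⨾x⋆≤x⋆ Y))))

  ⋆-mono : ∀ {X Y} → X ≤ Y → X ⋆ ≤ Y ⋆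
  ⋆-mono X≤Y = ≤⋆⇒⋆≤⋆ (≤-trans X≤Y (x≤x⋆ _))

  ⋆⨾⋆≤⋆ : ∀ {A B T} → A ≤ T → B ≤ T → A ⋆ ⨾ B ⋆ ≤ T ⋆
  ⋆⨾⋆≤⋆ A≤T B≤T = ≤-trans (⨾-mono (⋆-mono A≤T) (⋆-mono B≤T)) (x⋆⨾x⋆≤x⋆ _)

  ⋆-ᵀ : ∀ R → (R ⋆) ᵀ ≡ (R ᵀ) ⋆
  ⋆-ᵀ R = ≤-antisym (⋆ᵀ≤ᵀ⋆ R)
    (ᵀ-mono⁻ (subst (((R ᵀ) ⋆) ᵀ ≤_) (trans (cong _⋆ (ᵀ-invol R)) (sym (ᵀ-invol _))) (⋆ᵀ≤ᵀ⋆ (R ᵀ))))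
    where
      ⋆ᵀ≤ᵀ⋆ : ∀ R → (R ⋆) ᵀ ≤ (R ᵀ) ⋆
      ⋆ᵀ≤ᵀ⋆ R = subst ((R ⋆) ᵀ ≤_) (ᵀ-invol _)
        (ᵀ-mono (subst (_≤ Q) (⨾-identityʳ _) (star-inductˡ R I Q (∪-lub I≤Q R⨾Q≤Q))))
        where
          Q = ((R ᵀ) ⋆) ᵀ
          I≤Q : I ≤ Q
          I≤Q = subst (_≤ Q) ᵀ-identity (ᵀ-mono (I≤⋆ (R ᵀ)))
          R⨾Q≤Q : R ⨾ Q ≤ Q
          R⨾Q≤Q = begin
            R ⨾ Q                 ≡⟨ cong (_⨾ Q) (ᵀ-invol R) ⟨
            (R ᵀ) ᵀ ⨾ Q           ≡⟨ ᵀ-⨾ _ _ ⟨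
            ((R ᵀ) ⋆ ⨾ R ᵀ) ᵀ     ≤⟨ ᵀ-mono (x⋆⨾x≤x⋆ (R ᵀ)) ⟩
            Q                     ∎

  ᵀ≤⋆⇒⋆≡ᵀ⋆ : ∀ {T} → T ᵀ ≤ T ⋆ → T ⋆ ≡ (T ᵀ) ⋆
  ᵀ≤⋆⇒⋆≡ᵀ⋆ {T} Tᵀ≤T⋆ = ≤-antisym
    (≤⋆⇒⋆≤⋆ (subst₂ _≤_ (ᵀ-invol T) (⋆-ᵀ T) (ᵀ-mono Tᵀ≤T⋆)))
    (≤⋆⇒⋆≤⋆ Tᵀ≤T⋆)

  IsVector : Carrier → Set c
  IsVector v = v ⨾ L ≡ v

  ⨾L-vector : ∀ Q → IsVector (Q ⨾ L)
  ⨾L-vector Q = trans (⨾-assoc Q L L) (cong (Q ⨾_) L⨾L≡L)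

  ∁-vector : ∀ {v} → IsVector v → IsVector (∁ v)
  ∁-vector {v} v-vec = ≤-antisym (∩∁≤O⇒≤ (begin
    ∁ v ⨾ L ∩ ∁ (∁ v)             ≤⟨ dedekind′ (∁ v) L (∁ (∁ v)) ⟩
    (∁ v ∩ ∁ (∁ v) ⨾ L ᵀ) ⨾ L     ≡⟨ cong (λ z → (∁ v ∩ z) ⨾ L) (trans (cong₂ _⨾_ (∁-involutive v) Lᵀ≡L) v-vec) ⟩
    (∁ v ∩ v) ⨾ L                 ≡⟨ cong (_⨾ L) (trans (∩-comm _ _) (x∩∁x≡O v)) ⟩
    O ⨾ L                         ≤⟨ ⨾-zeroˡ L ⟩
    O                             ∎)) x≤x⨾L

  ∩-vector : ∀ {v w} → IsVector v → IsVector w → IsVector (v ∩ w)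
  ∩-vector v-vec w-vec = ≤-antisym
    (∩-glb (≤-trans (⨾-monoˡ L x∩y≤x) (≤-reflexive v-vec)) (≤-trans (⨾-monoˡ L x∩y≤y) (≤-reflexive w-vec)))
    x≤x⨾L

  sp-vector : ∀ Q → IsVector (sp Q)
  sp-vector Q = ∩-vector (⨾L-vector Q) (∁-vector (⨾L-vector (Q ᵀ)))

  ep-vector : ∀ Q → IsVector (ep Q)
  ep-vector Q = ∩-vector (⨾L-vector (Q ᵀ)) (∁-vector (⨾L-vector Q))

  L⨾vᵀ≡vᵀ : ∀ {v} → IsVector v → L ⨾ v ᵀ ≡ v ᵀ
  L⨾vᵀ≡vᵀ {v} v-vec = trans (cong (_⨾ v ᵀ) (sym Lᵀ≡L)) (trans (sym (ᵀ-⨾ v L)) (cong _ᵀ v-vec))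

  ⨾v∩wᵀ⨾≤⨾v⨾wᵀ⨾ : ∀ {v w} X Y → IsVector v → IsVector w → X ⨾ v ∩ w ᵀ ⨾ Y ≤ X ⨾ (v ⨾ (w ᵀ ⨾ Y))
  ⨾v∩wᵀ⨾≤⨾v⨾wᵀ⨾ {v} {w} X Y v-vec w-vec = begin
    X ⨾ v ∩ w ᵀ ⨾ Y                    ≤⟨ dedekind X v _ ⟩
    X ⨾ (v ∩ X ᵀ ⨾ (w ᵀ ⨾ Y))          ≤⟨ ⨾-monoʳ X (∩-mono ≤-refl (⨾-monoˡ _ x≤L)) ⟩
    X ⨾ (v ∩ L ⨾ (w ᵀ ⨾ Y))            ≤⟨ ⨾-monoʳ X (v∩W≤v⨾W (L ⨾ (w ᵀ ⨾ Y))) ⟩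
    X ⨾ (v ⨾ (L ⨾ (w ᵀ ⨾ Y)))          ≡⟨ cong (λ z → X ⨾ (v ⨾ z)) (trans (sym (⨾-assoc _ _ _)) (cong (_⨾ Y) (L⨾vᵀ≡vᵀ w-vec))) ⟩
    X ⨾ (v ⨾ (w ᵀ ⨾ Y))                ∎
    where
      v∩W≤v⨾W : ∀ W → v ∩ W ≤ v ⨾ W
      v∩W≤v⨾W W = begin
        v ∩ W                 ≤⟨ ∩-glb (≤-trans x∩y≤y (≤-reflexive (sym (⨾-identityˡ W)))) x∩y≤x ⟩
        I ⨾ W ∩ v             ≤⟨ dedekind′ I W v ⟩
        (I ∩ v ⨾ W ᵀ) ⨾ W     ≤⟨ ⨾-monoˡ W (≤-trans x∩y≤y (≤-trans (⨾-monoʳ v x≤L) (≤-reflexive v-vec))) ⟩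
        v ⨾ W                 ∎

  vᵀ⨾v≡L : ∀ {v} → IsVector v → ¬ (v ≡ O) → v ᵀ ⨾ v ≡ L
  vᵀ⨾v≡L {v} v-vec v≢O = trans (sym L⨾vᵀ⨾v⨾L≡vᵀ⨾v) (tarski-⇒ (v ᵀ ⨾ v) vᵀ⨾v≢O)
    where
      vᵀ⨾v≢O : ¬ (v ᵀ ⨾ v ≡ O)
      vᵀ⨾v≢O vᵀ⨾v≡O = v≢O (x≤O⇒x≡O (begin
        v                 ≤⟨ x≤x⨾xᵀ⨾x v ⟩
        v ⨾ v ᵀ ⨾ v       ≡⟨ ⨾-assoc _ _ _ ⟩
        v ⨾ (v ᵀ ⨾ v)     ≡⟨ cong (v ⨾_) vᵀ⨾v≡O ⟩
        v ⨾ O             ≤⟨ ⨾-zeroʳ v ⟩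
        O                 ∎))
      L⨾vᵀ⨾v⨾L≡vᵀ⨾v : L ⨾ (v ᵀ ⨾ v) ⨾ L ≡ v ᵀ ⨾ v
      L⨾vᵀ⨾v⨾L≡vᵀ⨾v = trans (cong (_⨾ L) (trans (sym (⨾-assoc _ _ _)) (cong (_⨾ v) (L⨾vᵀ≡vᵀ v-vec))))
                            (trans (⨾-assoc _ _ _) (cong (v ᵀ ⨾_) v-vec))

module PathLaws {c : Level} (K : KleeneRelationAlgebra c) where
  open KleeneRelationAlgebra K
  open BooleanLaws K
  open RelationLaws K
  open ≤-Reasoning ≤-poset

  sp-ᵀ : ∀ Q → sp (Q ᵀ) ≡ ep Q
  sp-ᵀ Q = cong (λ z → Q ᵀ ⨾ L ∩ ∁ (z ⨾ L)) (ᵀ-invol Q)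

  ep-ᵀ : ∀ Q → ep (Q ᵀ) ≡ sp Q
  ep-ᵀ Q = cong (λ z → z ⨾ L ∩ ∁ (Q ᵀ ⨾ L)) (ᵀ-invol Q)

  ep-O : ∀ {Q} → Q ≡ O → ep Q ≡ O
  ep-O refl = x≤O⇒x≡O (≤-trans x∩y≤x (subst (λ z → z ⨾ L ≤ O) (sym Oᵀ≡O) (⨾-zeroˡ L)))

  connected-ᵀ : ∀ {Q} → connected Q → connected (Q ᵀ)
  connected-ᵀ {Q} conn = begin
    Q ᵀ ⨾ L ⨾ Q ᵀ               ≡⟨ ᵀ-Q⨾L⨾Q ⟨
    (Q ⨾ L ⨾ Q) ᵀ               ≤⟨ ᵀ-mono conn ⟩
    (Q ⋆ ∪ (Q ᵀ) ⋆) ᵀ           ≡⟨ ᵀ-∪ _ _ ⟩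
    (Q ⋆) ᵀ ∪ ((Q ᵀ) ⋆) ᵀ       ≡⟨ cong₂ _∪_ (⋆-ᵀ Q) (⋆-ᵀ (Q ᵀ)) ⟩
    (Q ᵀ) ⋆ ∪ ((Q ᵀ) ᵀ) ⋆       ∎
    where
      ᵀ-Q⨾L⨾Q : (Q ⨾ L ⨾ Q) ᵀ ≡ Q ᵀ ⨾ L ⨾ Q ᵀ
      ᵀ-Q⨾L⨾Q = trans (ᵀ-⨾ _ _)
        (trans (cong (Q ᵀ ⨾_) (trans (ᵀ-⨾ _ _) (cong (_⨾ Q ᵀ) Lᵀ≡L))) (sym (⨾-assoc _ _ _)))

  -- A start point has no predecessor, so only the forward half Q ⋆ of connectivity applies.
  sp⨾L⨾x≤x⋆ : ∀ {Q} → connected Q → sp Q ⨾ L ⨾ Q ≤ Q ⋆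
  sp⨾L⨾x≤x⋆ {Q} conn = ≤-∪-elimʳ X≤Q⋆∪Qᵀ⋆ (begin
    X ∩ (Q ᵀ) ⋆                          ≤⟨ ∩-mono ≤-refl (⋆-unfold-≤ (Q ᵀ)) ⟩
    X ∩ (I ∪ Q ᵀ ⨾ (Q ᵀ) ⋆)              ≤⟨ ∩-distribˡ-∪ _ _ _ ⟩
    (X ∩ I) ∪ (X ∩ Q ᵀ ⨾ (Q ᵀ) ⋆)        ≤⟨ ∪-lub (∩-glb (≤-trans x∩y≤x X≤s) X∩I≤Qᵀ⨾L)
                                                   (∩-glb (≤-trans x∩y≤x X≤s) (≤-trans x∩y≤y (⨾-monoʳ _ x≤L))) ⟩
    s ∩ Q ᵀ ⨾ L                          ≤⟨ ≤∁⇒∩≤O x∩y≤y ⟩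
    O                                    ∎)
    where
      s = sp Q
      X = s ⨾ L ⨾ Q
      X≤Q⋆∪Qᵀ⋆ : X ≤ Q ⋆ ∪ (Q ᵀ) ⋆
      X≤Q⋆∪Qᵀ⋆ = ≤-trans (⨾-monoˡ Q (≤-trans (⨾-monoˡ L x∩y≤x) (≤-reflexive (⨾L-vector Q)))) conn
      X≤s : X ≤ s
      X≤s = ≤-trans (⨾-monoʳ _ x≤L) (≤-reflexive (trans (⨾L-vector s) (sp-vector Q)))
      X∩I≤Qᵀ⨾L : X ∩ I ≤ Q ᵀ ⨾ L
      X∩I≤Qᵀ⨾L = begin
        X ∩ I                 ≤⟨ ∩-mono (⨾-monoˡ Q x≤L) ≤-refl ⟩
        L ⨾ Q ∩ I             ≤⟨ dedekind′ L Q I ⟩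
        (L ∩ I ⨾ Q ᵀ) ⨾ Q     ≤⟨ ⨾-monoˡ Q x∩y≤y ⟩
        I ⨾ Q ᵀ ⨾ Q           ≡⟨ cong (_⨾ Q) (⨾-identityˡ _) ⟩
        Q ᵀ ⨾ Q               ≤⟨ ⨾-monoʳ _ x≤L ⟩
        Q ᵀ ⨾ L               ∎

  x⨾L⨾epᵀ≤x⋆ : ∀ {Q} → connected Q → Q ⨾ L ⨾ (ep Q) ᵀ ≤ Q ⋆
  x⨾L⨾epᵀ≤x⋆ {Q} conn = begin
    Q ⨾ L ⨾ e ᵀ               ≡⟨ ᵀ-e⨾L⨾Qᵀ ⟨
    (e ⨾ L ⨾ Q ᵀ) ᵀ           ≤⟨ ᵀ-mono (subst (λ z → z ⨾ L ⨾ Q ᵀ ≤ (Q ᵀ) ⋆) (sp-ᵀ Q) (sp⨾L⨾x≤x⋆ (connected-ᵀ conn))) ⟩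
    ((Q ᵀ) ⋆) ᵀ               ≡⟨ trans (⋆-ᵀ (Q ᵀ)) (cong _⋆ (ᵀ-invol Q)) ⟩
    Q ⋆                       ∎
    where
      e = ep Q
      ᵀ-e⨾L⨾Qᵀ : (e ⨾ L ⨾ Q ᵀ) ᵀ ≡ Q ⨾ L ⨾ e ᵀ
      ᵀ-e⨾L⨾Qᵀ = trans (ᵀ-⨾ _ _)
        (trans (cong₂ _⨾_ (ᵀ-invol Q) (trans (ᵀ-⨾ _ _) (cong (_⨾ e ᵀ) Lᵀ≡L))) (sym (⨾-assoc _ _ _)))

  -- An end point has no successor, so the identity part of Q ⋆ is excluded.
  x⨾L⨾epᵀ≤x⨾x⋆ : ∀ {Q} → connected Q → Q ⨾ L ⨾ (ep Q) ᵀ ≤ Q ⨾ Q ⋆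
  x⨾L⨾epᵀ≤x⨾x⋆ {Q} conn = ≤-∪-elimˡ (≤-trans (x⨾L⨾epᵀ≤x⋆ conn) (⋆-unfold-≤ Q))
    (≤-trans (∩-glb (≤-trans (∩-mono (⨾-monoˡ _ x≤L) ≤-refl) L⨾eᵀ∩I≤e) (≤-trans x∩y≤x X≤Q⨾L))
             (≤∁⇒∩≤O x∩y≤y))
    where
      e = ep Q
      X≤Q⨾L : Q ⨾ L ⨾ e ᵀ ≤ Q ⨾ L
      X≤Q⨾L = ≤-trans (⨾-monoʳ _ x≤L) (≤-reflexive (⨾L-vector Q))
      L⨾eᵀ∩I≤e : L ⨾ e ᵀ ∩ I ≤ e
      L⨾eᵀ∩I≤e = begin
        L ⨾ e ᵀ ∩ I                   ≤⟨ dedekind′ L (e ᵀ) I ⟩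
        (L ∩ I ⨾ (e ᵀ) ᵀ) ⨾ e ᵀ       ≤⟨ ⨾-monoˡ _ x∩y≤y ⟩
        I ⨾ (e ᵀ) ᵀ ⨾ e ᵀ             ≡⟨ cong (_⨾ e ᵀ) (trans (⨾-identityˡ _) (ᵀ-invol e)) ⟩
        e ⨾ e ᵀ                       ≤⟨ ⨾-monoʳ e x≤L ⟩
        e ⨾ L                         ≡⟨ ep-vector Q ⟩
        e                             ∎

  -- Tarski's rule gives L = epᵀ ⨾ ep, so after Q ⨾ L every step can be routed through the end point.
  xᵀ⨾L≤x⋆⨾ep : ∀ {Q} → univalent Q → connected Q → ¬ (ep Q ≡ O) → Q ᵀ ⨾ L ≤ Q ⋆ ⨾ ep Q
  xᵀ⨾L≤x⋆⨾ep {Q} uni conn e≢O = begin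
    Q ᵀ ⨾ L                     ≤⟨ ⨾-monoˡ L (subst (λ z → Q ᵀ ≤ Q ᵀ ⨾ z ⨾ Q ᵀ) (ᵀ-invol Q) (x≤x⨾xᵀ⨾x (Q ᵀ))) ⟩
    Q ᵀ ⨾ Q ⨾ Q ᵀ ⨾ L           ≤⟨ ⨾-monoˡ L (⨾-monoʳ _ x≤L) ⟩
    Q ᵀ ⨾ Q ⨾ L ⨾ L             ≡⟨ ⨾L-vector _ ⟩
    Q ᵀ ⨾ Q ⨾ L                 ≡⟨ cong (Q ᵀ ⨾ Q ⨾_) (vᵀ⨾v≡L (ep-vector Q) e≢O) ⟨
    Q ᵀ ⨾ Q ⨾ (e ᵀ ⨾ e)         ≡⟨ reassociate ⟩
    Q ᵀ ⨾ (Q ⨾ L ⨾ e ᵀ) ⨾ e     ≤⟨ ⨾-monoˡ e (⨾-monoʳ _ (x⨾L⨾epᵀ≤x⨾x⋆ conn)) ⟩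
    Q ᵀ ⨾ (Q ⨾ Q ⋆) ⨾ e         ≡⟨ cong (_⨾ e) (⨾-assoc _ _ _) ⟨
    Q ᵀ ⨾ Q ⨾ Q ⋆ ⨾ e           ≤⟨ ⨾-monoˡ e (⨾-monoˡ _ uni) ⟩
    I ⨾ Q ⋆ ⨾ e                 ≡⟨ cong (_⨾ e) (⨾-identityˡ _) ⟩
    Q ⋆ ⨾ e                     ∎
    where
      e = ep Q
      reassociate : Q ᵀ ⨾ Q ⨾ (e ᵀ ⨾ e) ≡ Q ᵀ ⨾ (Q ⨾ L ⨾ e ᵀ) ⨾ e
      reassociate = begin-equality
        Q ᵀ ⨾ Q ⨾ (e ᵀ ⨾ e)           ≡⟨ cong (λ z → Q ᵀ ⨾ Q ⨾ (z ⨾ e)) (L⨾vᵀ≡vᵀ (ep-vector Q)) ⟨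
        Q ᵀ ⨾ Q ⨾ (L ⨾ e ᵀ ⨾ e)       ≡⟨ ⨾-assoc _ _ _ ⟨
        Q ᵀ ⨾ Q ⨾ (L ⨾ e ᵀ) ⨾ e       ≡⟨ cong (_⨾ e) (⨾-assoc _ _ _) ⟩
        Q ᵀ ⨾ (Q ⨾ (L ⨾ e ᵀ)) ⨾ e     ≡⟨ cong (λ z → Q ᵀ ⨾ z ⨾ e) (⨾-assoc _ _ _) ⟨
        Q ᵀ ⨾ (Q ⨾ L ⨾ e ᵀ) ⨾ e       ∎

  x⨾L≤x⋆⨾ep : ∀ {Q} → univalent Q → connected Q → ¬ (ep Q ≡ O) → Q ⨾ L ≤ Q ⋆ ⨾ ep Q
  x⨾L≤x⋆⨾ep {Q} uni conn e≢O = begin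
    Q ⨾ L                   ≤⟨ ⨾-monoˡ L (x≤x⨾xᵀ⨾x Q) ⟩
    Q ⨾ Q ᵀ ⨾ Q ⨾ L         ≡⟨ ⨾-assoc _ _ _ ⟩
    Q ⨾ Q ᵀ ⨾ (Q ⨾ L)       ≤⟨ ⨾-monoʳ _ x≤L ⟩
    Q ⨾ Q ᵀ ⨾ L             ≡⟨ ⨾-assoc _ _ _ ⟩
    Q ⨾ (Q ᵀ ⨾ L)           ≤⟨ ⨾-monoʳ Q (xᵀ⨾L≤x⋆⨾ep uni conn e≢O) ⟩
    Q ⨾ (Q ⋆ ⨾ ep Q)        ≡⟨ ⨾-assoc _ _ _ ⟨
    Q ⨾ Q ⋆ ⨾ ep Q          ≤⟨ ⨾-monoˡ _ (x⨾x⋆≤x⋆ Q) ⟩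
    Q ⋆ ⨾ ep Q              ∎

  x⨾L⨾y≤x⋆⨾y⋆ : ∀ {P Q} → univalent P → connected P → ¬ (ep P ≡ O) → connected Q →
                sp Q ≡ ep P → P ⨾ L ⨾ Q ≤ P ⋆ ⨾ Q ⋆
  x⨾L⨾y≤x⋆⨾y⋆ {P} {Q} uni conn e≢O connQ spQ≡epP = begin
    P ⨾ L ⨾ Q               ≤⟨ ⨾-monoˡ Q (x⨾L≤x⋆⨾ep uni conn e≢O) ⟩
    P ⋆ ⨾ ep P ⨾ Q          ≡⟨ ⨾-assoc _ _ _ ⟩
    P ⋆ ⨾ (ep P ⨾ Q)        ≡⟨ cong (λ z → P ⋆ ⨾ (z ⨾ Q)) (trans (sp-vector Q) spQ≡epP) ⟨
    P ⋆ ⨾ (sp Q ⨾ L ⨾ Q)    ≤⟨ ⨾-monoʳ _ (sp⨾L⨾x≤x⋆ connQ) ⟩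
    P ⋆ ⨾ Q ⋆               ∎

  -- A backward step along P is replaced by walking forward to the end of P, along Q back to
  -- the start of P, and forward along P again.
  xᵀ≤x⋆⨾y⋆⨾x⋆ : ∀ {P Q} → IsPath P → connected Q → ¬ (sp P ≡ O) → ¬ (ep P ≡ O) →
                sp Q ≡ ep P → ep Q ≡ sp P → P ᵀ ≤ P ⋆ ⨾ (Q ⋆ ⨾ P ⋆)
  xᵀ≤x⋆⨾y⋆⨾x⋆ {P} {Q} (inj , uni , conn) connQ s≢O e≢O spQ≡epP epQ≡spP = begin
    P ᵀ                         ≤⟨ ∩-glb x≤x⨾L (ᵀ-mono x≤x⨾L) ⟩
    P ᵀ ⨾ L ∩ (P ⨾ L) ᵀ         ≤⟨ ∩-mono (xᵀ⨾L≤x⋆⨾ep uni conn e≢O) [P⨾L]ᵀ≤spᵀ⨾P⋆ ⟩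
    P ⋆ ⨾ e ∩ s ᵀ ⨾ P ⋆         ≤⟨ ⨾v∩wᵀ⨾≤⨾v⨾wᵀ⨾ (P ⋆) (P ⋆) (ep-vector P) (sp-vector P) ⟩
    P ⋆ ⨾ (e ⨾ (s ᵀ ⨾ P ⋆))     ≡⟨ cong (P ⋆ ⨾_) (⨾-assoc _ _ _) ⟨
    P ⋆ ⨾ (e ⨾ s ᵀ ⨾ P ⋆)       ≤⟨ ⨾-monoʳ _ (⨾-monoˡ _ e⨾sᵀ≤Q⋆) ⟩
    P ⋆ ⨾ (Q ⋆ ⨾ P ⋆)           ∎
    where
      s = sp P
      e = ep P
      P⨾L≤Pᵀ⋆⨾s : P ⨾ L ≤ (P ᵀ) ⋆ ⨾ s
      P⨾L≤Pᵀ⋆⨾s = subst₂ (λ u v → u ⨾ L ≤ (P ᵀ) ⋆ ⨾ v) (ᵀ-invol P) (ep-ᵀ P)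
        (xᵀ⨾L≤x⋆⨾ep (subst (λ z → z ⨾ P ᵀ ≤ I) (sym (ᵀ-invol P)) inj) (connected-ᵀ conn)
                    (λ epPᵀ≡O → s≢O (trans (sym (ep-ᵀ P)) epPᵀ≡O)))
      [P⨾L]ᵀ≤spᵀ⨾P⋆ : (P ⨾ L) ᵀ ≤ s ᵀ ⨾ P ⋆
      [P⨾L]ᵀ≤spᵀ⨾P⋆ = begin
        (P ⨾ L) ᵀ               ≤⟨ ᵀ-mono P⨾L≤Pᵀ⋆⨾s ⟩
        ((P ᵀ) ⋆ ⨾ s) ᵀ         ≡⟨ ᵀ-⨾ _ _ ⟩
        s ᵀ ⨾ ((P ᵀ) ⋆) ᵀ       ≡⟨ cong (s ᵀ ⨾_) (trans (⋆-ᵀ (P ᵀ)) (cong _⋆ (ᵀ-invol P))) ⟩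
        s ᵀ ⨾ P ⋆               ∎
      e⨾sᵀ≤Q⋆ : e ⨾ s ᵀ ≤ Q ⋆
      e⨾sᵀ≤Q⋆ = begin
        e ⨾ s ᵀ                 ≡⟨ cong (λ z → e ⨾ z ᵀ) epQ≡spP ⟨
        e ⨾ (ep Q) ᵀ            ≤⟨ ⨾-monoʳ e (ᵀ-mono x∩y≤x) ⟩
        e ⨾ (Q ᵀ ⨾ L) ᵀ         ≡⟨ cong (e ⨾_) (trans (ᵀ-⨾ _ _) (cong₂ _⨾_ Lᵀ≡L (ᵀ-invol Q))) ⟩
        e ⨾ (L ⨾ Q)             ≡⟨ ⨾-assoc _ _ _ ⟨
        e ⨾ L ⨾ Q               ≡⟨ cong (λ z → z ⨾ L ⨾ Q) spQ≡epP ⟨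
        sp Q ⨾ L ⨾ Q            ≤⟨ sp⨾L⨾x≤x⋆ connQ ⟩
        Q ⋆                     ∎

module UnionOfPaths {c : Level} (K : KleeneRelationAlgebra c) where
  open KleeneRelationAlgebra K
  open BooleanLaws K
  open RelationLaws K
  open PathLaws K
  open ≤-Reasoning ≤-poset

  HasEndpoints : Carrier → Set c
  HasEndpoints R = ¬ (sp R ≡ O) × ¬ (ep R ≡ O)

  terminating-cases : ∀ {R} → IsTerminating R → HasEndpoints R ⊎ R ≡ O
  terminating-cases (_ , inj₂ R≡O , _)          = inj₂ R≡O
  terminating-cases (_ , _ , inj₂ R≡O)          = inj₂ R≡O
  terminating-cases (_ , inj₁ s≢O , inj₁ e≢O)   = inj₁ (s≢O , e≢O)

  terminating-partner-O : ∀ {R S} → IsTerminating S → sp S ≡ ep R → R ≡ O → S ≡ O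
  terminating-partner-O (_ , inj₁ s≢O , _) spS≡epR R≡O = ⊥-elim (s≢O (trans spS≡epR (ep-O R≡O)))
  terminating-partner-O (_ , inj₂ S≡O , _) _ _         = S≡O

  O∪O-cycle : ∀ {R S} → R ≡ O → S ≡ O → IsCycle (R ∪ S)
  O∪O-cycle refl refl = subst IsCycle (sym (∪-idem O)) ((O-injective , O-univalent , O-connected) , cong _⋆ (sym Oᵀ≡O))
    where
      O-injective : injective O
      O-injective = ≤-trans (⨾-zeroˡ _) O≤x
      O-univalent : univalent O
      O-univalent = ≤-trans (⨾-zeroʳ _) O≤x
      O-connected : connected O
      O-connected = ≤-trans (⨾-zeroʳ _) O≤x

  ranges-disjoint : ∀ {R S} → sp S ≡ ep R → R ⨾ L ∩ ((R ᵀ) ⨾ L ∪ S ⨾ L) ∩ (S ᵀ) ⨾ L ≡ O →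
                    R ᵀ ⨾ L ∩ S ᵀ ⨾ L ≤ O
  ranges-disjoint {R} {S} spS≡epR overlap≡O =
    ≤-trans (∩-glb ≤-refl (∩∁≤O⇒≤ outside-R⨾L)) inside-R⨾L
    where
      inside-R⨾L : (R ᵀ ⨾ L ∩ S ᵀ ⨾ L) ∩ R ⨾ L ≤ O
      inside-R⨾L = begin
        (R ᵀ ⨾ L ∩ S ᵀ ⨾ L) ∩ R ⨾ L                   ≤⟨ ∩-glb (∩-glb x∩y≤y (≤-trans (≤-trans x∩y≤x x∩y≤x) x≤x∪y))
                                                               (≤-trans x∩y≤x x∩y≤y) ⟩
        R ⨾ L ∩ ((R ᵀ) ⨾ L ∪ S ⨾ L) ∩ (S ᵀ) ⨾ L       ≡⟨ overlap≡O ⟩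
        O                                             ∎
      outside-R⨾L : (R ᵀ ⨾ L ∩ S ᵀ ⨾ L) ∩ ∁ (R ⨾ L) ≤ O
      outside-R⨾L = begin
        (R ᵀ ⨾ L ∩ S ᵀ ⨾ L) ∩ ∁ (R ⨾ L)   ≤⟨ ∩-glb (∩-mono x∩y≤x ≤-refl) (≤-trans x∩y≤x x∩y≤y) ⟩
        ep R ∩ S ᵀ ⨾ L                    ≡⟨ cong (_∩ S ᵀ ⨾ L) spS≡epR ⟨
        sp S ∩ S ᵀ ⨾ L                    ≤⟨ ≤∁⇒∩≤O x∩y≤y ⟩
        O                                 ∎

  domains-disjoint : ∀ {R S} → sp S ≡ ep R → R ⨾ L ∩ ((R ᵀ) ⨾ L ∪ S ⨾ L) ∩ (S ᵀ) ⨾ L ≡ O →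
                     R ⨾ L ∩ S ⨾ L ≤ O
  domains-disjoint {R} {S} spS≡epR overlap≡O =
    ≤-trans (∩-glb ≤-refl (∩∁≤O⇒≤ outside-Sᵀ⨾L)) inside-Sᵀ⨾L
    where
      inside-Sᵀ⨾L : (R ⨾ L ∩ S ⨾ L) ∩ S ᵀ ⨾ L ≤ O
      inside-Sᵀ⨾L = begin
        (R ⨾ L ∩ S ⨾ L) ∩ S ᵀ ⨾ L                     ≤⟨ ∩-glb (∩-glb (≤-trans x∩y≤x x∩y≤x) (≤-trans (≤-trans x∩y≤x x∩y≤y) y≤x∪y))
                                                               x∩y≤y ⟩
        R ⨾ L ∩ ((R ᵀ) ⨾ L ∪ S ⨾ L) ∩ (S ᵀ) ⨾ L       ≡⟨ overlap≡O ⟩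
        O                                             ∎
      outside-Sᵀ⨾L : (R ⨾ L ∩ S ⨾ L) ∩ ∁ (S ᵀ ⨾ L) ≤ O
      outside-Sᵀ⨾L = begin
        (R ⨾ L ∩ S ⨾ L) ∩ ∁ (S ᵀ ⨾ L)     ≤⟨ ∩-glb (∩-mono x∩y≤y ≤-refl) (≤-trans x∩y≤x x∩y≤x) ⟩
        sp S ∩ R ⨾ L                      ≡⟨ cong (_∩ R ⨾ L) spS≡epR ⟩
        ep R ∩ R ⨾ L                      ≤⟨ ≤∁⇒∩≤O x∩y≤y ⟩
        O                                 ∎

  disjoint-ranges⇒⨾ᵀ≤O : ∀ {A B} → A ᵀ ⨾ L ∩ B ᵀ ⨾ L ≤ O → A ⨾ B ᵀ ≤ O
  disjoint-ranges⇒⨾ᵀ≤O {A} {B} disjoint = begin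
    A ⨾ B ᵀ                     ≤⟨ ∩-glb ≤-refl x≤L ⟩
    A ⨾ B ᵀ ∩ L                 ≤⟨ dedekind A (B ᵀ) L ⟩
    A ⨾ (B ᵀ ∩ A ᵀ ⨾ L)         ≤⟨ ⨾-monoʳ A (∩-glb x∩y≤y (≤-trans x∩y≤x x≤x⨾L)) ⟩
    A ⨾ (A ᵀ ⨾ L ∩ B ᵀ ⨾ L)     ≤⟨ ⨾-monoʳ A disjoint ⟩
    A ⨾ O                       ≤⟨ ⨾-zeroʳ A ⟩
    O                           ∎

  disjoint-domains⇒ᵀ⨾≤O : ∀ {A B} → A ⨾ L ∩ B ⨾ L ≤ O → A ᵀ ⨾ B ≤ O
  disjoint-domains⇒ᵀ⨾≤O {A} {B} disjoint = subst (λ z → A ᵀ ⨾ z ≤ O) (ᵀ-invol B)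
    (disjoint-ranges⇒⨾ᵀ≤O (subst₂ (λ u v → u ⨾ L ∩ v ⨾ L ≤ O) (sym (ᵀ-invol A)) (sym (ᵀ-invol B)) disjoint))

  ∪⨾∪≤ : ∀ {A B C D Z} → A ⨾ C ≤ Z → A ⨾ D ≤ Z → B ⨾ C ≤ Z → B ⨾ D ≤ Z → (A ∪ B) ⨾ (C ∪ D) ≤ Z
  ∪⨾∪≤ {A} {B} {C} {D} {Z} AC≤Z AD≤Z BC≤Z BD≤Z = begin
    (A ∪ B) ⨾ (C ∪ D)                       ≡⟨ ⨾-distribʳ _ _ _ ⟩
    A ⨾ (C ∪ D) ∪ B ⨾ (C ∪ D)               ≡⟨ cong₂ _∪_ (⨾-distribˡ _ _ _) (⨾-distribˡ _ _ _) ⟩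
    (A ⨾ C ∪ A ⨾ D) ∪ (B ⨾ C ∪ B ⨾ D)       ≤⟨ ∪-lub (∪-lub AC≤Z AD≤Z) (∪-lub BC≤Z BD≤Z) ⟩
    Z                                       ∎

  ∪-injective : ∀ {A B} → injective A → injective B → A ⨾ B ᵀ ≤ O → injective (A ∪ B)
  ∪-injective {A} {B} injA injB A⨾Bᵀ≤O = subst (λ z → (A ∪ B) ⨾ z ≤ I) (sym (ᵀ-∪ A B))
    (∪⨾∪≤ injA (≤-trans A⨾Bᵀ≤O O≤x) (≤-trans B⨾Aᵀ≤O O≤x) injB)
    where
      B⨾Aᵀ≤O : B ⨾ A ᵀ ≤ O
      B⨾Aᵀ≤O = ᵀ≤O⇒≤O (subst (_≤ O) (sym (ᵀ-⨾ᵀ B A)) A⨾Bᵀ≤O)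

  ∪-univalent : ∀ {A B} → univalent A → univalent B → A ᵀ ⨾ B ≤ O → univalent (A ∪ B)
  ∪-univalent {A} {B} uniA uniB Aᵀ⨾B≤O = subst (λ z → z ⨾ (A ∪ B) ≤ I) (sym (ᵀ-∪ A B))
    (∪⨾∪≤ uniA (≤-trans Aᵀ⨾B≤O O≤x) (≤-trans Bᵀ⨾A≤O O≤x) uniB)
    where
      Bᵀ⨾A≤O : B ᵀ ⨾ A ≤ O
      Bᵀ⨾A≤O = ᵀ≤O⇒≤O (subst (_≤ O) (sym (ᵀ-ᵀ⨾ B A)) Aᵀ⨾B≤O)

  ∪-connected : ∀ {R S} → connected R → connected S →
                R ⨾ L ⨾ S ≤ R ⋆ ⨾ S ⋆ → S ⨾ L ⨾ R ≤ S ⋆ ⨾ R ⋆ → connected (R ∪ S)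
  ∪-connected {R} {S} connR connS R⨾L⨾S≤ S⨾L⨾R≤ =
    subst (λ z → z ⨾ (R ∪ S) ≤ (R ∪ S) ⋆ ∪ ((R ∪ S) ᵀ) ⋆) (sym (⨾-distribʳ R S L))
      (∪⨾∪≤ (≤-trans connR (∪-mono (⋆-mono x≤x∪y) (⋆-mono Rᵀ≤[R∪S]ᵀ)))
            (≤-trans R⨾L⨾S≤ (≤-trans (⋆⨾⋆≤⋆ x≤x∪y y≤x∪y) x≤x∪y))
            (≤-trans S⨾L⨾R≤ (≤-trans (⋆⨾⋆≤⋆ y≤x∪y x≤x∪y) x≤x∪y))
            (≤-trans connS (∪-mono (⋆-mono y≤x∪y) (⋆-mono Sᵀ≤[R∪S]ᵀ))))
    where
      Rᵀ≤[R∪S]ᵀ : R ᵀ ≤ (R ∪ S) ᵀ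
      Rᵀ≤[R∪S]ᵀ = ᵀ-mono x≤x∪y
      Sᵀ≤[R∪S]ᵀ : S ᵀ ≤ (R ∪ S) ᵀ
      Sᵀ≤[R∪S]ᵀ = ᵀ-mono y≤x∪y

  ∪ᵀ≤∪⋆ : ∀ {R S} → R ᵀ ≤ R ⋆ ⨾ (S ⋆ ⨾ R ⋆) → S ᵀ ≤ S ⋆ ⨾ (R ⋆ ⨾ S ⋆) → (R ∪ S) ᵀ ≤ (R ∪ S) ⋆
  ∪ᵀ≤∪⋆ {R} {S} Rᵀ≤ Sᵀ≤ = begin
    (R ∪ S) ᵀ                                 ≡⟨ ᵀ-∪ R S ⟩
    R ᵀ ∪ S ᵀ                                 ≤⟨ ∪-mono Rᵀ≤ Sᵀ≤ ⟩
    R ⋆ ⨾ (S ⋆ ⨾ R ⋆) ∪ S ⋆ ⨾ (R ⋆ ⨾ S ⋆)     ≤⟨ ∪-lub (around x≤x∪y y≤x∪y) (around y≤x∪y x≤x∪y) ⟩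
    (R ∪ S) ⋆                                 ∎
    where
      around : ∀ {A B} → A ≤ R ∪ S → B ≤ R ∪ S → A ⋆ ⨾ (B ⋆ ⨾ A ⋆) ≤ (R ∪ S) ⋆
      around A≤ B≤ = ≤-trans (⨾-mono (⋆-mono A≤) (⋆⨾⋆≤⋆ B≤ A≤)) (x⋆⨾x⋆≤x⋆ _)

  ∪-cycle : ∀ {R S} → IsPath R → IsPath S → HasEndpoints R → HasEndpoints S →
            sp R ≡ ep S → sp S ≡ ep R → R ⨾ S ᵀ ≤ O → R ᵀ ⨾ S ≤ O → IsCycle (R ∪ S)
  ∪-cycle pathR@(injR , uniR , connR) pathS@(injS , uniS , connS) (s≢O[R] , e≢O[R]) (s≢O[S] , e≢O[S])
          spR≡epS spS≡epR R⨾Sᵀ≤O Rᵀ⨾S≤O =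
    ( ∪-injective injR injS R⨾Sᵀ≤O
    , ∪-univalent uniR uniS Rᵀ⨾S≤O
    , ∪-connected connR connS (x⨾L⨾y≤x⋆⨾y⋆ uniR connR e≢O[R] connS spS≡epR)
                              (x⨾L⨾y≤x⋆⨾y⋆ uniS connS e≢O[S] connR spR≡epS) )
    , ᵀ≤⋆⇒⋆≡ᵀ⋆ (∪ᵀ≤∪⋆ (xᵀ≤x⋆⨾y⋆⨾x⋆ pathR connS s≢O[R] e≢O[R] spS≡epR (sym spR≡epS))
                      (xᵀ≤x⋆⨾y⋆⨾x⋆ pathS connR s≢O[S] e≢O[S] spR≡epS (sym spS≡epR)))

  terminating-∪-cycle : ∀ R S → IsTerminating R → IsTerminating S → sp R ≡ ep S → sp S ≡ ep R →
                        R ⨾ L ∩ ((R ᵀ) ⨾ L ∪ S ⨾ L) ∩ (S ᵀ) ⨾ L ≡ O → IsCycle (R ∪ S)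
  terminating-∪-cycle R S termR termS spR≡epS spS≡epR overlap≡O
    with terminating-cases termR | terminating-cases termS
  ... | inj₂ R≡O   | _          = O∪O-cycle R≡O (terminating-partner-O termS spS≡epR R≡O)
  ... | _          | inj₂ S≡O   = O∪O-cycle (terminating-partner-O termR spR≡epS S≡O) S≡O
  ... | inj₁ endsR | inj₁ endsS =
    ∪-cycle (proj₁ termR) (proj₁ termS) endsR endsS spR≡epS spS≡epR
      (disjoint-ranges⇒⨾ᵀ≤O (ranges-disjoint spS≡epR overlap≡O))
      (disjoint-domains⇒ᵀ⨾≤O (domains-disjoint spS≡epR overlap≡O))

mainTheorem13 : ∀ {c : Level} (K : KleeneRelationAlgebra c) →
    let open KleeneRelationAlgebra K in
    ∀ (R S : Carrier) →
      IsTerminating R → IsTerminating S →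
      sp R ≡ ep S → sp S ≡ ep R →
      R ⨾ L ∩ ((R ᵀ) ⨾ L ∪ S ⨾ L) ∩ (S ᵀ) ⨾ L ≡ O →
      IsCycle (R ∪ S)
mainTheorem13 K = UnionOfPaths.terminating-∪-cycle K
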